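{- Suppose that every constant function lifts locators, i.e. for each $c:\mathbb{R}_D$ we are given an element of $\prod_{x:\mathbb{R}_D}\operatorname{locator}(x)\to\operatorname{locator}(c)$ (lifting structure for the constant function $x\mapsto c$). Then every $x:\mathbb{R}_D$ comes equipped with a locator, i.e. one obtains an element of $\prod_{x:\mathbb{R}_D}\operatorname{locator}(x)$.
   Context: Work in Martin-Löf type theory with propositional truncation, function extensionality and propositional extensionality. A Dedekind real is a pair $x=(L,U)$ of proposition-valued predicates on $\mathbb{Q}$, writing $q<x$ for $q\in L$ and $x<r$ for $r\in U$, which is bounded, rounded, transitive and located ($q<r\Rightarrow\|(q<x)+(x<r)\|$). $\mathbb{R}_D$ is the type of Dedekind reals. A locator for $x$ is a function $\prod_{q,r:\mathbb{Q}}(q<r)\to(q<x)+(x<r)$ into the untruncated disjoint sum; $\operatorname{locator}(x)$ is the type of these. A function $f:\mathbb{R}_D\to\mathbb{R}_D$ lifts locators if it is equipped with an element of $\prod_{x:\mathbb{R}_D}\operatorname{locator}(x)\to\operatorname{locator}(f(x))$. -}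

module Defs where

open import Data.Rational using (ℚ; _<_)
open import Data.Product using (Σ; _×_)
open import Data.Sum using (_⊎_)
open import Relation.Binary.PropositionalEquality using (_≡_)

isProp : Set → Set
isProp A = (a b : A) → a ≡ b

-- Propositional truncation, via the impredicative encoding (landing in Set₁):
-- ∥ A ∥ eliminates into every proposition P : Set.
∥_∥ : Set → Set₁
∥ A ∥ = (P : Set) → isProp P → (A → P) → P

-- Dedekind reals: q < x  is  lower x q,  x < r  is  upper x r.
record ℝD : Set₁ where
  field
    lower upper   : ℚ → Set
    lower-isProp  : ∀ q → isProp (lower q)
    upper-isProp  : ∀ r → isProp (upper r)
    bounded-lower : ∥ Σ ℚ lower ∥
    bounded-upper : ∥ Σ ℚ upper ∥
    rounded-lower→ : ∀ q → lower q → ∥ Σ ℚ (λ q′ → (q < q′) × lower q′) ∥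
    rounded-lower← : ∀ q → ∥ Σ ℚ (λ q′ → (q < q′) × lower q′) ∥ → lower q
    rounded-upper→ : ∀ r → upper r → ∥ Σ ℚ (λ r′ → (r′ < r) × upper r′) ∥
    rounded-upper← : ∀ r → ∥ Σ ℚ (λ r′ → (r′ < r) × upper r′) ∥ → upper r
    transitive    : ∀ q r → lower q → upper r → q < r
    located       : ∀ q r → q < r → ∥ lower q ⊎ upper r ∥

open ℝD public

Locator : ℝD → Set
Locator x = (q r : ℚ) → q < r → lower x q ⊎ upper x r

LiftsLocators : (ℝD → ℝD) → Set₁
LiftsLocators f = (x : ℝD) → Locator x → Locator (f x)

module Submission where

-- A lifting structure for the constant function  _ ↦ c  turns a locator of
-- ANY real into a locator of c.  So it suffices to exhibit one real that
-- carries a locator.  Every rational a gives a Dedekind real  ι a  with cuts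
-- q < a  and  a < r, and since the order on ℚ is decidable, ι a has an
-- honest (untruncated) locator: for q < r decide  q < a; if not, a ≤ q < r.

open import Defs
open import Data.Rational using (ℚ; _<_; _+_; _-_; -_; 0ℚ; 1ℚ)
open import Data.Rational.Properties
  using (<-dense; <-trans; ≤-<-trans; <-irrelevant; _<?_; ≮⇒≥; +-monoʳ-<; +-identityʳ)
open import Data.Product using (Σ; _×_; _,_)
open import Data.Sum using (_⊎_; inj₁; inj₂)
open import Function using (_∘_)
open import Relation.Binary.PropositionalEquality using (subst)
open import Relation.Nullary using (yes; no)
open import Relation.Nullary.Decidable using (toWitness)

∣_∣ : {A : Set} → A → ∥ A ∥
∣ a ∣ _ _ k = k a

mapT : {A B : Set} → (A → B) → ∥ A ∥ → ∥ B ∥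
mapT f t P P-isProp k = t P P-isProp (λ a → k (f a))

untruncate : {A : Set} → isProp A → ∥ A ∥ → A
untruncate A-isProp t = t _ A-isProp (λ a → a)

0<1 : 0ℚ < 1ℚ
0<1 = toWitness {a? = 0ℚ <? 1ℚ} _

-1<0 : - 1ℚ < 0ℚ
-1<0 = toWitness {a? = - 1ℚ <? 0ℚ} _

<-suc : (a : ℚ) → a < a + 1ℚ
<-suc a = subst (_< a + 1ℚ) (+-identityʳ a) (+-monoʳ-< a 0<1)

<-pred : (a : ℚ) → a - 1ℚ < a
<-pred a = subst (a - 1ℚ <_) (+-identityʳ a) (+-monoʳ-< a -1<0)

<-located : (a q r : ℚ) → q < r → (q < a) ⊎ (a < r)
<-located a q r q<r with q <? a
... | yes q<a = inj₁ q<a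
... | no  q≮a = inj₂ (≤-<-trans (≮⇒≥ q≮a) q<r)

ι : ℚ → ℝD
ι a = record
  { lower          = _< a
  ; upper          = a <_
  ; lower-isProp   = λ _ → <-irrelevant
  ; upper-isProp   = λ _ → <-irrelevant
  ; bounded-lower  = ∣ a - 1ℚ , <-pred a ∣
  ; bounded-upper  = ∣ a + 1ℚ , <-suc a ∣
  ; rounded-lower→ = λ q q<a → let (m , q<m , m<a) = <-dense q<a in ∣ m , q<m , m<a ∣
  ; rounded-lower← = λ q → untruncate <-irrelevant
                       ∘ mapT (λ { (q′ , q<q′ , q′<a) → <-trans q<q′ q′<a })
  ; rounded-upper→ = λ r a<r → let (m , a<m , m<r) = <-dense a<r in ∣ m , m<r , a<m ∣
  ; rounded-upper← = λ r → untruncate <-irrelevant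
                       ∘ mapT (λ { (r′ , r′<r , a<r′) → <-trans a<r′ r′<r })
  ; transitive     = λ _ _ → <-trans
  ; located        = λ q r q<r → ∣ <-located a q r q<r ∣
  }

ι-locator : (a : ℚ) → Locator (ι a)
ι-locator = <-located

lemma4p7 : ((c : ℝD) → LiftsLocators (λ _ → c)) → (x : ℝD) → Locator x
lemma4p7 constLifts x = constLifts x (ι 0ℚ) (ι-locator 0ℚ)
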